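{- For every $n\ge 1$, $$C_n=\sum_{\pi\in \mathrm{pAv}_n(312,321)}\ \prod_{i\in B(\pi)} C_{i-1}=\sum_{k=1}^n\ \sum_{m\in \mathfrak{C}_{n-k,k}} C_{m_1}C_{m_2}\cdots C_{m_k},$$ where $C_m=\frac{1}{m+1}\binom{2m}{m}$.
   Context: $\mathrm{pAv}_n(312,321)$ is the set of permutations of $\{1,\dots,n\}$ avoiding both patterns $312$ and $321$ (a permutation $\sigma$ contains $\pi=\pi(1)\dots\pi(k)$ if there are indices $i_1<\dots<i_k$ with $\sigma(i_a)<\sigma(i_b)$ iff $\pi(a)<\pi(b)$; otherwise it avoids $\pi$). For $n\ge 1$, $w_n$ denotes the permutation $23\dots n1$, and the direct sum of permutations corresponds to the block-diagonal sum of their permutation matrices $\begin{pmatrix}A&0\\0&B\end{pmatrix}$. Every $\pi\in\mathrm{pAv}_n(312,321)$ can be written uniquely as $w_{m_1}\oplus\cdots\oplus w_{m_k}$ with $(m_1,\dots,m_k)$ a composition of $n$ into positive parts; $B(\pi)$ denotes this composition (and the product over $i\in B(\pi)$ is over its parts $m_1,\dots,m_k$). $\mathfrak{C}_{N,k}$ is the set of weak compositions $m=(m_1,\dots,m_k)$ of $N$ into $k$ parts (nonnegative integers summing to $N$). -}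

module Defs where

open import Data.Nat using (ℕ; zero; suc; _+_; _*_; _∸_; _<ᵇ_; _≡ᵇ_)
open import Data.Nat.DivMod using (_/_)
open import Data.Nat.Combinatorics using (_C_)
open import Data.Bool using (Bool; true; false; _∧_; if_then_else_)
open import Data.List using (List; []; _∷_; _++_; map; concatMap; filter; length; upTo; zip; applyUpTo)
open import Data.Bool.ListAction using (all; any)
open import Data.List.Relation.Unary.All using (All)
open import Data.Product using (_,_)

-- Catalan number C_m = (1/(m+1)) * binom(2m, m)  (exact division)
catalan : ℕ → ℕ
catalan m = ((2 * m) C m) / suc m

_==_ : Bool → Bool → Bool
true == b = b
false == true = false
false == false = true

-- Permutations are lists of values; a permutation of {1..n} is a list
-- containing each of 1..n exactly once.

insertions : ℕ → List ℕ → List (List ℕ)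
insertions x [] = (x ∷ []) ∷ []
insertions x (y ∷ ys) = (x ∷ y ∷ ys) ∷ map (y ∷_) (insertions x ys)

perms : List ℕ → List (List ℕ)
perms [] = [] ∷ []
perms (x ∷ xs) = concatMap (insertions x) (perms xs)

Sym : ℕ → List (List ℕ)
Sym n = perms (applyUpTo suc n)

subseqs : List ℕ → List (List ℕ)
subseqs [] = [] ∷ []
subseqs (x ∷ xs) = map (x ∷_) (subseqs xs) ++ subseqs xs

sameLength : List ℕ → List ℕ → Bool
sameLength [] [] = true
sameLength (_ ∷ xs) (_ ∷ ys) = sameLength xs ys
sameLength _ _ = false

orderIso : List ℕ → List ℕ → Bool
orderIso [] [] = true
orderIso (x ∷ xs) (y ∷ ys) =
  all (λ { (x' , y') → ((x <ᵇ x') == (y <ᵇ y')) ∧ ((x' <ᵇ x) == (y' <ᵇ y)) }) (zip xs ys)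
  ∧ orderIso xs ys
orderIso _ _ = false

contains : List ℕ → List ℕ → Bool
contains σ π = any (λ s → sameLength s π ∧ orderIso s π) (subseqs σ)

avoids : List ℕ → List ℕ → Bool
avoids σ π = if contains σ π then false else true

pAv312-321 : ℕ → List (List ℕ)
pAv312-321 n =
  filter (λ σ → Data.Bool.T? (avoids σ (3 ∷ 1 ∷ 2 ∷ []) ∧ avoids σ (3 ∷ 2 ∷ 1 ∷ [])))
         (Sym n)

-- w_m = 2 3 ... m 1  (m ≥ 1); w_0 is the empty permutation (never used)
w : ℕ → List ℕ
w zero = []
w (suc m) = applyUpTo (λ i → i + 2) m ++ (1 ∷ [])

_⊕_ : List ℕ → List ℕ → List ℕ
a ⊕ b = a ++ map (_+ length a) b

directSum : List ℕ → List ℕ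
directSum [] = []
directSum (m ∷ ms) = w m ⊕ directSum ms

weakComps : ℕ → ℕ → List (List ℕ)
weakComps N zero = if N ≡ᵇ 0 then [] ∷ [] else []
weakComps N (suc k) = concatMap (λ a → map (a ∷_) (weakComps (N ∸ a) k)) (upTo (suc N))

allPositive : List ℕ → Bool
allPositive [] = true
allPositive (zero ∷ _) = false
allPositive (suc _ ∷ xs) = allPositive xs

comps : ℕ → List (List ℕ)
comps n = filter (λ c → Data.Bool.T? (allPositive c))
                 (concatMap (weakComps n) (upTo (suc n)))

eqList : List ℕ → List ℕ → Bool
eqList [] [] = true
eqList (x ∷ xs) (y ∷ ys) = (x ≡ᵇ y) ∧ eqList xs ys
eqList _ _ = false

-- B(π): the composition (m_1,...,m_k) of n with π = w_{m_1} ⊕ ... ⊕ w_{m_k}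
-- (the first such composition found; it is unique when it exists; [] if none)
firstMatch : List ℕ → List (List ℕ) → List ℕ
firstMatch π [] = []
firstMatch π (c ∷ cs) = if eqList (directSum c) π then c else firstMatch π cs

B : ℕ → List ℕ → List ℕ
B n π = firstMatch π (comps n)

{-# OPTIONS --safe #-}

-- A permutation avoids 312 and 321 exactly when no entry is followed by two smaller
-- entries. In such a permutation of an interval, every entry before the minimum has the
-- minimum as its one smaller successor, so these entries increase and are the next
-- consecutive values: the permutation begins with a shifted w_m. Hence pAv_n(312,321)
-- consists of the direct sums w_{m₁} ⊕ ⋯ ⊕ w_{m_k}, one for each composition m of n,
-- and lowering every part by one turns the first sum into the second.
--
-- The k-th term of the second sum is the coefficient of x^(n−k) in C(x)^k, C = 1 + xC²
-- the Catalan series. Writing b(k, m) for the coefficient of x^m in C(x)^k, the relation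
-- C^(k+1) = C^k + x·C^(k+2) gives b(k+1, m+1) = b(k, m+1) + b(k+2, m), which unrolls to
-- C_n = b(1, n) = Σ_k b(k, n−k). Taking this recurrence as the definition of b, the closed
-- form b(k, m)·(k+2m) = k·binom(k+2m, m) propagates through it, so b(1, m) is the Catalan
-- number, and a strong induction shows that b(k+1, ·) is the convolution of b(1, ·) with
-- b(k, ·), so that b(k, ·) really lists the coefficients of C(x)^k.

module Submission where

open import Data.Bool using (true; false; T; T?; _∧_)
open import Data.Bool.Properties using (T-≡; T-∧)
open import Data.Empty using (⊥; ⊥-elim)
open import Data.List using (List; []; _∷_; _++_; map; concatMap; filter; length; applyUpTo; upTo)
open import Data.List.Membership.Propositional using (_∈_; _∉_; find; lose)
open import Data.List.Membership.Propositional.Properties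
open import Data.List.Membership.Propositional.Properties.WithK using (unique∧set⇒bag)
open import Data.List.Properties
  using ( ++-assoc; ++-conicalʳ; length-++; map-++; map-∘; map-cong; map-cong-local; map-id; map-injective
        ; map-upTo; ∷-injective; ∷-injectiveʳ)
open import Data.List.Relation.Binary.BagAndSetEquality using (∼bag⇒↭)
open import Data.List.Relation.Binary.Disjoint.Propositional using (Disjoint)
open import Data.List.Relation.Binary.Permutation.Propositional
  using (_↭_; ↭-refl; ↭-sym; ↭-trans; ↭-prep; ↭⇒↭ₛ)
import Data.List.Relation.Binary.Permutation.Propositional.Properties as ↭
import Data.List.Relation.Binary.Permutation.Setoid.Properties as Permutationₛ
open import Data.List.Relation.Binary.Sublist.Propositional using (_⊆_; []; _∷_; _∷ʳ_; to∈; from∈)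
open import Data.List.Relation.Unary.All as All using (All; []; _∷_)
import Data.List.Relation.Unary.All.Properties as All
open import Data.List.Relation.Unary.Any using (here; there)
open import Data.List.Relation.Unary.Any.Properties using (any⁺; any⁻)
open import Data.List.Relation.Unary.Unique.Propositional using (Unique; []; _∷_; tail)
open import Data.List.Relation.Unary.Unique.Propositional.Properties
  using (map⁺; ++⁺; filter⁺; upTo⁺; Unique[x∷xs]⇒x∉xs)
open import Data.Nat using (ℕ; zero; suc; _+_; _*_; _∸_; _≤_; _<_; _<ᵇ_; _≤?_; z≤n; s≤s)
open import Data.Nat.Combinatorics using (_C_; nC1≡n; nCk≡nC[n∸k]; k>n⇒nCk≡0; nCk+nC[k+1]≡[n+1]C[k+1])
open import Data.Nat.DivMod using (_/_; m*n/n≡m)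
open import Data.Nat.Induction using (<-rec)
open import Data.Nat.ListAction using (sum; product)
open import Data.Nat.ListAction.Properties using (sum-++; sum-↭)
open import Data.Nat.Properties
open import Data.Nat.Tactic.RingSolver using (solve-∀)
open import Data.Product using (∃; ∃₂; _×_; _,_; proj₁; proj₂)
open import Data.Sum using (inj₁; inj₂)
open import Data.Unit using (⊤; tt)
open import Function using (_∘_; _⇔_; mk⇔; Equivalence; case_of_)
open import Relation.Binary.Definitions using (tri<; tri≈; tri>)
open import Relation.Binary.PropositionalEquality
open import Relation.Nullary using (¬_; yes; no; contradiction)
open import Relation.Unary using (Decidable)

open import Defs

open ≡-Reasoning

private variable
  A A′ : Set


applyUpTo-cong : ∀ {f g : ℕ → A} n → (∀ i → i < n → f i ≡ g i) → applyUpTo f n ≡ applyUpTo g n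
applyUpTo-cong zero    f≗g = refl
applyUpTo-cong (suc n) f≗g =
  cong₂ _∷_ (f≗g 0 (s≤s z≤n)) (applyUpTo-cong n (λ i i<n → f≗g (suc i) (s≤s i<n)))

sum-map-concatMap : (h : A′ → ℕ) (g : A → List A′) (xs : List A) →
                    sum (map h (concatMap g xs)) ≡ sum (map (λ x → sum (map h (g x))) xs)
sum-map-concatMap h g []       = refl
sum-map-concatMap h g (x ∷ xs) = begin
  sum (map h (g x ++ concatMap g xs))              ≡⟨ cong sum (map-++ h (g x) (concatMap g xs)) ⟩
  sum (map h (g x) ++ map h (concatMap g xs))      ≡⟨ sum-++ (map h (g x)) _ ⟩
  sum (map h (g x)) + sum (map h (concatMap g xs)) ≡⟨ cong (sum (map h (g x)) +_) (sum-map-concatMap h g xs) ⟩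
  sum (map h (g x)) + sum (map (λ x → sum (map h (g x))) xs) ∎

sum-map-*ˡ : ∀ c (h : A → ℕ) xs → sum (map (λ x → c * h x) xs) ≡ c * sum (map h xs)
sum-map-*ˡ c h []       = sym (*-zeroʳ c)
sum-map-*ˡ c h (x ∷ xs) = trans (cong (c * h x +_) (sum-map-*ˡ c h xs)) (sym (*-distribˡ-+ c (h x) _))

sum-map-filter : ∀ {P : A → Set} (P? : Decidable P) (g h : A → ℕ) xs →
                 (∀ {x} → P x → g x ≡ h x) → (∀ {x} → ¬ P x → h x ≡ 0) →
                 sum (map g (filter P? xs)) ≡ sum (map h xs)
sum-map-filter P? g h []       _   _   = refl
sum-map-filter P? g h (x ∷ xs) g≡h h≡0 with P? x
... | yes px = cong₂ _+_ (g≡h px) (sum-map-filter P? g h xs g≡h h≡0)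
... | no ¬px = trans (sum-map-filter P? g h xs g≡h h≡0) (cong (_+ sum (map h xs)) (sym (h≡0 ¬px)))


-- Binomial coefficients and ballot numbers

[1+k]*[1+n]C[1+k]≡[1+n]*nCk : ∀ n k → suc k * (suc n C suc k) ≡ suc n * (n C k)
[1+k]*[1+n]C[1+k]≡[1+n]*nCk n zero = begin
  1 * (suc n C 1) ≡⟨ *-identityˡ _ ⟩
  suc n C 1       ≡⟨ nC1≡n (suc n) ⟩
  suc n           ≡⟨ *-identityʳ (suc n) ⟨
  suc n * 1       ∎
[1+k]*[1+n]C[1+k]≡[1+n]*nCk zero (suc k) = begin
  suc (suc k) * (1 C suc (suc k)) ≡⟨ cong (suc (suc k) *_) (k>n⇒nCk≡0 {1} {suc (suc k)} (s≤s (s≤s z≤n))) ⟩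
  suc (suc k) * 0                 ≡⟨ *-zeroʳ (suc (suc k)) ⟩
  0                               ≡⟨ k>n⇒nCk≡0 {0} {suc k} (s≤s z≤n) ⟨
  1 * (0 C suc k)                 ∎
[1+k]*[1+n]C[1+k]≡[1+n]*nCk (suc n) (suc k) = begin
  suc (suc k) * (suc (suc n) C suc (suc k))
    ≡⟨ cong (suc (suc k) *_) (nCk+nC[k+1]≡[n+1]C[k+1] (suc n) (suc k)) ⟨
  suc (suc k) * (X + Y)
    ≡⟨ split k X Y ⟩
  X + (suc k * X + suc (suc k) * Y)
    ≡⟨ cong₂ (λ u v → X + (u + v)) ([1+k]*[1+n]C[1+k]≡[1+n]*nCk n k)
                                    ([1+k]*[1+n]C[1+k]≡[1+n]*nCk n (suc k)) ⟩
  X + (suc n * (n C k) + suc n * (n C suc k))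
    ≡⟨ cong (X +_) (*-distribˡ-+ (suc n) (n C k) (n C suc k)) ⟨
  X + suc n * ((n C k) + (n C suc k))
    ≡⟨ cong (λ u → X + suc n * u) (nCk+nC[k+1]≡[n+1]C[k+1] n k) ⟩
  X + suc n * X
    ≡⟨⟩
  suc (suc n) * X ∎
  where
  X = suc n C suc k
  Y = suc n C suc (suc k)
  split : ∀ k x y → suc (suc k) * (x + y) ≡ x + (suc k * x + suc (suc k) * y)
  split = solve-∀

[1+m]*[m+r]C[1+m]≡r*[m+r]Cm : ∀ m r → suc m * ((m + r) C suc m) ≡ r * ((m + r) C m)
[1+m]*[m+r]C[1+m]≡r*[m+r]Cm m r = +-cancelˡ-≡ (suc m * X) _ _ (begin
  suc m * X + suc m * Y ≡⟨ *-distribˡ-+ (suc m) X Y ⟨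
  suc m * (X + Y)       ≡⟨ cong (suc m *_) (nCk+nC[k+1]≡[n+1]C[k+1] (m + r) m) ⟩
  suc m * (suc (m + r) C suc m) ≡⟨ [1+k]*[1+n]C[1+k]≡[1+n]*nCk (m + r) m ⟩
  suc (m + r) * X       ≡⟨ split m r X ⟩
  suc m * X + r * X     ∎)
  where
  X = (m + r) C m
  Y = (m + r) C suc m
  split : ∀ m r x → suc (m + r) * x ≡ suc m * x + r * x
  split = solve-∀

-- ballot k m is the coefficient of x^m in C(x)^k.
ballot : ℕ → ℕ → ℕ
ballot zero    zero    = 1
ballot zero    (suc m) = 0
ballot (suc k) zero    = 1
ballot (suc k) (suc m) = ballot k (suc m) + ballot (suc (suc k)) m

ballot-zero : ∀ k → ballot k 0 ≡ 1
ballot-zero zero    = refl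
ballot-zero (suc k) = refl

ballot-closed-step : ∀ k m {A B N′} → let N = suc (suc (k + m + m)) in
  N′ ≡ N → A * N′ ≡ k * (N′ C suc m) → B * N ≡ suc (suc k) * (N C m) →
  (A + B) * suc N′ ≡ suc k * (suc N′ C suc m)
ballot-closed-step k m {A} {B} refl A-closed B-closed = *-cancelˡ-≡ _ _ (suc m * N) (begin
  suc m * N * ((A + B) * suc N)
    ≡⟨ expand (suc m) N A B ⟩
  suc N * (suc m * (A * N) + suc m * (B * N))
    ≡⟨ cong₂ (λ u v → suc N * (suc m * u + suc m * v)) A-closed B-closed ⟩
  suc N * (suc m * (k * Y) + suc m * (suc (suc k) * X))
    ≡⟨ cong (λ u → suc N * (u + suc m * (suc (suc k) * X))) (*-comm-middle (suc m) k Y) ⟩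
  suc N * (k * (suc m * Y) + suc m * (suc (suc k) * X))
    ≡⟨ cong (λ u → suc N * (k * u + suc m * (suc (suc k) * X))) ratio ⟩
  suc N * (k * (suc (suc (k + m)) * X) + suc m * (suc (suc k) * X))
    ≡⟨ collect k m X ⟩
  N * suc k * (suc N * X)
    ≡⟨ cong (N * suc k *_) ([1+k]*[1+n]C[1+k]≡[1+n]*nCk N m) ⟨
  N * suc k * (suc m * Z)
    ≡⟨ *-comm-outer N (suc k) (suc m) Z ⟩
  suc m * N * (suc k * Z) ∎)
  where
  N = suc (suc (k + m + m))
  X = N C m
  Y = N C suc m
  Z = suc N C suc m
  split-N : ∀ k m → m + suc (suc (k + m)) ≡ suc (suc (k + m + m))
  split-N = solve-∀
  ratio : suc m * Y ≡ suc (suc (k + m)) * X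
  ratio = subst (λ n → suc m * (n C suc m) ≡ suc (suc (k + m)) * (n C m)) (split-N k m)
                ([1+m]*[m+r]C[1+m]≡r*[m+r]Cm m (suc (suc (k + m))))
  expand : ∀ a n x y → a * n * ((x + y) * suc n) ≡ suc n * (a * (x * n) + a * (y * n))
  expand = solve-∀
  *-comm-middle : ∀ a b c → a * (b * c) ≡ b * (a * c)
  *-comm-middle = solve-∀
  *-comm-outer : ∀ a b c d → a * b * (c * d) ≡ c * a * (b * d)
  *-comm-outer = solve-∀
  collect : ∀ k m x → let n = suc (suc (k + m + m)) in
    suc n * (k * (suc (suc (k + m)) * x) + suc m * (suc (suc k) * x)) ≡ n * suc k * (suc n * x)
  collect = solve-∀

ballot-closed : ∀ k m → ballot k m * (k + m + m) ≡ k * ((k + m + m) C m)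
ballot-closed zero    zero    = refl
ballot-closed zero    (suc m) = refl
ballot-closed (suc k) zero    = unit-laws k
  where
  unit-laws : ∀ k → 1 * (suc k + 0 + 0) ≡ suc k * 1
  unit-laws = solve-∀
ballot-closed (suc k) (suc m) =
  ballot-closed-step k m {ballot k (suc m)} {ballot (suc (suc k)) m} (shape k m)
    (ballot-closed k (suc m)) (ballot-closed (suc (suc k)) m)
  where
  shape : ∀ k m → k + suc m + suc m ≡ suc (suc (k + m + m))
  shape = solve-∀

catalan≡ballot1 : ∀ m → catalan m ≡ ballot 1 m
catalan≡ballot1 m = begin
  ((2 * m) C m) / suc m          ≡⟨ cong (λ n → (n C m) / suc m) (cong (m +_) (+-identityʳ m)) ⟩
  ((m + m) C m) / suc m          ≡⟨ cong (_/ suc m) (*-cancelˡ-≡ _ _ (suc (m + m)) central) ⟨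
  ballot 1 m * suc m / suc m     ≡⟨ m*n/n≡m (ballot 1 m) (suc m) ⟩
  ballot 1 m                     ∎
  where
  symmetric : suc (m + m) C suc m ≡ suc (m + m) C m
  symmetric = trans (nCk≡nC[n∸k] (s≤s (m≤m+n m m))) (cong (suc (m + m) C_) (m+n∸m≡n m m))
  central : suc (m + m) * (ballot 1 m * suc m) ≡ suc (m + m) * ((m + m) C m)
  central = begin
    suc (m + m) * (ballot 1 m * suc m)  ≡⟨ *-comm-swap (suc (m + m)) (ballot 1 m) (suc m) ⟩
    suc m * (ballot 1 m * suc (m + m))  ≡⟨ cong (suc m *_) (trans (ballot-closed 1 m) (*-identityˡ _)) ⟩
    suc m * (suc (m + m) C m)           ≡⟨ cong (suc m *_) symmetric ⟨
    suc m * (suc (m + m) C suc m)       ≡⟨ [1+k]*[1+n]C[1+k]≡[1+n]*nCk (m + m) m ⟩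
    suc (m + m) * ((m + m) C m)         ∎
    where
    *-comm-swap : ∀ a b c → a * (b * c) ≡ c * (b * a)
    *-comm-swap = solve-∀

ballot-telescope : ∀ k m → ballot (suc k) m ≡ sum (applyUpTo (λ i → ballot (k + i) (m ∸ i)) (suc m))
ballot-telescope k zero    = sym (trans (+-identityʳ _) (ballot-zero (k + 0)))
ballot-telescope k (suc m) = cong₂ _+_ (cong (λ j → ballot j (suc m)) (sym (+-identityʳ k))) (begin
  ballot (suc (suc k)) m
    ≡⟨ ballot-telescope (suc k) m ⟩
  sum (applyUpTo (λ i → ballot (suc k + i) (m ∸ i)) (suc m))
    ≡⟨ cong sum (applyUpTo-cong (suc m) (λ i _ → cong (λ j → ballot j (m ∸ i)) (+-suc k i))) ⟨
  sum (applyUpTo (λ i → ballot (k + suc i) (m ∸ i)) (suc m)) ∎)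


conv : (ℕ → ℕ) → (ℕ → ℕ) → ℕ → ℕ
conv f g m = sum (applyUpTo (λ a → f a * g (m ∸ a)) (suc m))

conv-cong : ∀ {f f′ g g′} m → (∀ a → a ≤ m → f a ≡ f′ a) → (∀ a → a ≤ m → g a ≡ g′ a) →
            conv f g m ≡ conv f′ g′ m
conv-cong zero    f≗f′ g≗g′ = cong₂ (λ x y → x * y + 0) (f≗f′ 0 z≤n) (g≗g′ 0 z≤n)
conv-cong (suc m) f≗f′ g≗g′ = cong₂ _+_
  (cong₂ _*_ (f≗f′ 0 z≤n) (g≗g′ (suc m) ≤-refl))
  (conv-cong m (λ a a≤m → f≗f′ (suc a) (s≤s a≤m)) (λ a a≤m → g≗g′ a (m≤n⇒m≤1+n a≤m)))

conv-linearˡ : ∀ c f f′ h m → conv (λ a → c * f a + f′ a) h m ≡ c * conv f h m + conv f′ h m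
conv-linearˡ c f f′ h zero    = distrib₀ c (f 0) (f′ 0) (h 0)
  where
  distrib₀ : ∀ c x y z → (c * x + y) * z + 0 ≡ c * (x * z + 0) + (y * z + 0)
  distrib₀ = solve-∀
conv-linearˡ c f f′ h (suc m) = begin
  (c * f 0 + f′ 0) * h (suc m) + conv (λ a → c * f (suc a) + f′ (suc a)) h m
    ≡⟨ cong ((c * f 0 + f′ 0) * h (suc m) +_) (conv-linearˡ c (f ∘ suc) (f′ ∘ suc) h m) ⟩
  (c * f 0 + f′ 0) * h (suc m) + (c * conv (f ∘ suc) h m + conv (f′ ∘ suc) h m)
    ≡⟨ distrib c (f 0) (f′ 0) (h (suc m)) (conv (f ∘ suc) h m) (conv (f′ ∘ suc) h m) ⟩
  c * (f 0 * h (suc m) + conv (f ∘ suc) h m) + (f′ 0 * h (suc m) + conv (f′ ∘ suc) h m) ∎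
  where
  distrib : ∀ c x y z u v → (c * x + y) * z + (c * u + v) ≡ c * (x * z + u) + (y * z + v)
  distrib = solve-∀

conv-assoc : ∀ f g h m → conv (conv f g) h m ≡ conv f (conv g h) m
conv-assoc f g h zero    = assoc₀ (f 0) (g 0) (h 0)
  where
  assoc₀ : ∀ x y z → (x * y + 0) * z + 0 ≡ x * (y * z + 0) + 0
  assoc₀ = solve-∀
conv-assoc f g h (suc m) = begin
  conv f g 0 * h (suc m) + conv (λ a → f 0 * g (suc a) + conv (f ∘ suc) g a) h m
    ≡⟨ cong (conv f g 0 * h (suc m) +_) (conv-linearˡ (f 0) (g ∘ suc) (conv (f ∘ suc) g) h m) ⟩
  conv f g 0 * h (suc m) + (f 0 * conv (g ∘ suc) h m + conv (conv (f ∘ suc) g) h m)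
    ≡⟨ cong (λ u → conv f g 0 * h (suc m) + (f 0 * conv (g ∘ suc) h m + u))
            (conv-assoc (f ∘ suc) g h m) ⟩
  (f 0 * g 0 + 0) * h (suc m) + (f 0 * conv (g ∘ suc) h m + conv (f ∘ suc) (conv g h) m)
    ≡⟨ regroup (f 0) (g 0) (h (suc m)) (conv (g ∘ suc) h m) (conv (f ∘ suc) (conv g h) m) ⟩
  f 0 * (g 0 * h (suc m) + conv (g ∘ suc) h m) + conv (f ∘ suc) (conv g h) m ∎
  where
  regroup : ∀ x y z u v → (x * y + 0) * z + (x * u + v) ≡ x * (y * z + u) + v
  regroup = solve-∀

ballot-conv : ∀ k m → ballot (suc k) m ≡ conv (ballot 1) (ballot k) m
ballot-conv k m = <-rec (λ m → ∀ k → ballot (suc k) m ≡ conv (ballot 1) (ballot k) m) step m k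
  where
  step : ∀ m → (∀ {m′} → m′ < m → ∀ k → ballot (suc k) m′ ≡ conv (ballot 1) (ballot k) m′) →
         ∀ k → ballot (suc k) m ≡ conv (ballot 1) (ballot k) m
  step zero    _  k = cong (λ b → 1 * b + 0) (sym (ballot-zero k))
  step (suc m) ih k = cong₂ _+_ (sym (*-identityˡ _)) (begin
    ballot (suc (suc k)) m
      ≡⟨ ih ≤-refl (suc k) ⟩
    conv (ballot 1) (ballot (suc k)) m
      ≡⟨ conv-cong {f = ballot 1} {g = ballot (suc k)} m (λ _ _ → refl) (λ b b≤m → ih (s≤s b≤m) k) ⟩
    conv (ballot 1) (conv (ballot 1) (ballot k)) m
      ≡⟨ conv-assoc (ballot 1) (ballot 1) (ballot k) m ⟨
    conv (conv (ballot 1) (ballot 1)) (ballot k) m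
      ≡⟨ conv-cong {f = ballot 2} {g = ballot k} m (λ a a≤m → ih (s≤s a≤m) 1) (λ _ _ → refl) ⟨
    conv (ballot 2) (ballot k) m ∎)

-- The coefficients of x·F(x) when f lists those of F(x).
shift : (ℕ → ℕ) → ℕ → ℕ
shift f zero    = 0
shift f (suc a) = f a

conv-zeroʳ : ∀ f m → conv f (λ _ → 0) m ≡ 0
conv-zeroʳ f zero    = cong (_+ 0) (*-zeroʳ (f 0))
conv-zeroʳ f (suc m) = cong₂ _+_ (*-zeroʳ (f 0)) (conv-zeroʳ (f ∘ suc) m)

conv-vanishingʳ : ∀ f {h} m → (∀ b → b ≤ m → h b ≡ 0) → conv f h m ≡ 0
conv-vanishingʳ f {h} m h≡0 = trans (conv-cong {f = f} {g = h} m (λ _ _ → refl) h≡0) (conv-zeroʳ f m)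

conv-translateʳ : ∀ f {h h′} N k → (∀ M → M < k → h M ≡ 0) → (∀ M → h (M + k) ≡ h′ M) →
                  conv f h (N + k) ≡ conv f h′ N
conv-translateʳ f zero    zero    _   h≡h′ = cong (λ x → f 0 * x + 0) (h≡h′ 0)
conv-translateʳ f zero    (suc k) h≡0 h≡h′ =
  cong₂ _+_ (cong (f 0 *_) (h≡h′ 0)) (conv-vanishingʳ (f ∘ suc) k (λ b b≤k → h≡0 b (s≤s b≤k)))
conv-translateʳ f (suc N) k       h≡0 h≡h′ =
  cong₂ _+_ (cong (f 0 *_) (h≡h′ (suc N))) (conv-translateʳ (f ∘ suc) N k h≡0 h≡h′)


-- Weighted sums over compositions

compositionSum : (ℕ → ℕ) → ℕ → ℕ → ℕ
compositionSum f k N = sum (map (λ c → product (map f c)) (weakComps N k))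

compositionSum-suc : ∀ f k N → compositionSum f (suc k) N ≡ conv f (compositionSum f k) N
compositionSum-suc f k N = begin
  sum (map weight (concatMap (λ a → map (a ∷_) (weakComps (N ∸ a) k)) (upTo (suc N))))
    ≡⟨ sum-map-concatMap weight (λ a → map (a ∷_) (weakComps (N ∸ a) k)) (upTo (suc N)) ⟩
  sum (map (λ a → sum (map weight (map (a ∷_) (weakComps (N ∸ a) k)))) (upTo (suc N)))
    ≡⟨ cong sum (map-cong with-first-part (upTo (suc N))) ⟩
  sum (map (λ a → f a * compositionSum f k (N ∸ a)) (upTo (suc N)))
    ≡⟨ cong sum (map-upTo (λ a → f a * compositionSum f k (N ∸ a)) (suc N)) ⟩
  conv f (compositionSum f k) N ∎
  where
  weight : List ℕ → ℕ
  weight c = product (map f c)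
  with-first-part : ∀ a → sum (map weight (map (a ∷_) (weakComps (N ∸ a) k))) ≡ f a * compositionSum f k (N ∸ a)
  with-first-part a = trans (cong sum (sym (map-∘ (weakComps (N ∸ a) k))))
                       (sum-map-*ˡ (f a) weight (weakComps (N ∸ a) k))

compositionSum-catalan : ∀ k m → compositionSum catalan k m ≡ ballot k m
compositionSum-catalan zero    zero    = refl
compositionSum-catalan zero    (suc m) = refl
compositionSum-catalan (suc k) m       = begin
  compositionSum catalan (suc k) m
    ≡⟨ compositionSum-suc catalan k m ⟩
  conv catalan (compositionSum catalan k) m
    ≡⟨ conv-cong m (λ a _ → catalan≡ballot1 a) (λ b _ → compositionSum-catalan k b) ⟩
  conv (ballot 1) (ballot k) m
    ≡⟨ ballot-conv k m ⟨
  ballot (suc k) m ∎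

catalan-suc≡sum-compositionSum : ∀ m →
  catalan (suc m) ≡ sum (applyUpTo (λ j → compositionSum catalan (suc j) (m ∸ j)) (suc m))
catalan-suc≡sum-compositionSum m = begin
  catalan (suc m)
    ≡⟨ catalan≡ballot1 (suc m) ⟩
  ballot 2 m
    ≡⟨ ballot-telescope 1 m ⟩
  sum (applyUpTo (λ i → ballot (suc i) (m ∸ i)) (suc m))
    ≡⟨ cong sum (applyUpTo-cong (suc m) (λ i _ → compositionSum-catalan (suc i) (m ∸ i))) ⟨
  sum (applyUpTo (λ j → compositionSum catalan (suc j) (m ∸ j)) (suc m)) ∎

compositionSum-shift-< : ∀ f k N → N < k → compositionSum (shift f) k N ≡ 0
compositionSum-shift-< f (suc k) zero    _         = compositionSum-suc (shift f) k 0
compositionSum-shift-< f (suc k) (suc N) (s≤s N<k) = trans (compositionSum-suc (shift f) k (suc N))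
  (conv-vanishingʳ f N (λ b b≤N → compositionSum-shift-< f k b (≤-<-trans b≤N N<k)))

compositionSum-shift : ∀ f k N → compositionSum (shift f) k (N + k) ≡ compositionSum f k N
compositionSum-shift f zero    N = trans (cong (compositionSum (shift f) 0) (+-identityʳ N)) (no-parts N)
  where
  no-parts : ∀ N → compositionSum (shift f) 0 N ≡ compositionSum f 0 N
  no-parts zero    = refl
  no-parts (suc N) = refl
compositionSum-shift f (suc k) N = begin
  compositionSum (shift f) (suc k) (N + suc k)
    ≡⟨ cong (compositionSum (shift f) (suc k)) (+-suc N k) ⟩
  compositionSum (shift f) (suc k) (suc (N + k))
    ≡⟨ compositionSum-suc (shift f) k (suc (N + k)) ⟩
  conv f (compositionSum (shift f) k) (N + k)
    ≡⟨ conv-translateʳ f N k (compositionSum-shift-< f k) (compositionSum-shift f k) ⟩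
  conv f (compositionSum f k) N
    ≡⟨ compositionSum-suc f k N ⟨
  compositionSum f (suc k) N ∎

positive? : Decidable (T ∘ allPositive)
positive? c = T? (allPositive c)

product-pred≡product-shift : ∀ f {c} → T (allPositive c) →
                             product (map (λ i → f (i ∸ 1)) c) ≡ product (map (shift f) c)
product-pred≡product-shift f {[]}        _   = refl
product-pred≡product-shift f {suc a ∷ c} pos = cong (f a *_) (product-pred≡product-shift f {c} pos)

product-shift≡0 : ∀ f {c} → ¬ T (allPositive c) → product (map (shift f) c) ≡ 0
product-shift≡0 f {[]}        ¬pos = contradiction tt ¬pos
product-shift≡0 f {zero ∷ c}  _    = refl
product-shift≡0 f {suc a ∷ c} ¬pos = trans (cong (f a *_) (product-shift≡0 f {c} ¬pos)) (*-zeroʳ (f a))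

-- Under shift f a composition with a zero part has weight 0, so the filter can be dropped.
sum-comps≡sum-compositionSum : ∀ f m →
  sum (map (λ c → product (map (λ i → f (i ∸ 1)) c)) (comps (suc m)))
    ≡ sum (applyUpTo (λ j → compositionSum f (suc j) (m ∸ j)) (suc m))
sum-comps≡sum-compositionSum f m = begin
  sum (map (λ c → product (map (λ i → f (i ∸ 1)) c)) (filter positive? weak))
    ≡⟨ sum-map-filter positive? _ _ weak (λ {c} → product-pred≡product-shift f {c})
                                         (λ {c} → product-shift≡0 f {c}) ⟩
  sum (map (λ c → product (map (shift f) c)) weak)
    ≡⟨ sum-map-concatMap _ (weakComps (suc m)) (upTo (suc (suc m))) ⟩
  sum (map (λ k → compositionSum (shift f) k (suc m)) (upTo (suc (suc m))))
    ≡⟨ cong sum (map-upTo (λ k → compositionSum (shift f) k (suc m)) (suc (suc m))) ⟩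
  sum (applyUpTo (λ k → compositionSum (shift f) k (suc m)) (suc (suc m)))
    ≡⟨⟩
  sum (applyUpTo (λ j → compositionSum (shift f) (suc j) (suc m)) (suc m))
    ≡⟨ cong sum (applyUpTo-cong (suc m) unshift) ⟩
  sum (applyUpTo (λ j → compositionSum f (suc j) (m ∸ j)) (suc m)) ∎
  where
  weak : List (List ℕ)
  weak = concatMap (weakComps (suc m)) (upTo (suc (suc m)))
  unshift : ∀ j → j < suc m → compositionSum (shift f) (suc j) (suc m) ≡ compositionSum f (suc j) (m ∸ j)
  unshift j (s≤s j≤m) = begin
    compositionSum (shift f) (suc j) (suc m)
      ≡⟨ cong (compositionSum (shift f) (suc j)) (trans (+-suc (m ∸ j) j) (cong suc (m∸n+n≡m j≤m))) ⟨
    compositionSum (shift f) (suc j) (m ∸ j + suc j)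
      ≡⟨ compositionSum-shift f (suc j) (m ∸ j) ⟩
    compositionSum f (suc j) (m ∸ j) ∎


unique-resp-↭ : {xs ys : List A} → xs ↭ ys → Unique xs → Unique ys
unique-resp-↭ {A = A} p = Permutationₛ.Unique-resp-↭ (setoid A) (↭⇒↭ₛ p)

unique∷ : {x : A} {xs : List A} → x ∉ xs → Unique xs → Unique (x ∷ xs)
unique∷ x∉xs xs! = All.¬Any⇒All¬ _ x∉xs ∷ xs!

unique∧set⇒↭ : {xs ys : List A} → Unique xs → Unique ys → (∀ {z} → z ∈ xs ⇔ z ∈ ys) → xs ↭ ys
unique∧set⇒↭ xs! ys! xs≈ys = ∼bag⇒↭ (unique∧set⇒bag xs! ys! xs≈ys)

concatMap-unique : (f : A → List A′) {xs : List A} → Unique xs → (∀ {x} → x ∈ xs → Unique (f x)) →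
                   (∀ {x y} → x ∈ xs → y ∈ xs → x ≢ y → Disjoint (f x) (f y)) →
                   Unique (concatMap f xs)
concatMap-unique f {[]}     _    _   _        = []
concatMap-unique f {x ∷ xs} xs!  f!  disjoint = ++⁺ (f! (here refl))
  (concatMap-unique f (tail xs!) (f! ∘ there) (λ x∈ y∈ → disjoint (there x∈) (there y∈)))
  λ (z∈fx , z∈rest) → case ∈-concat⁻′ (map f xs) z∈rest of λ where
    (_ , z∈fy , fy∈) → case ∈-map⁻ f fy∈ of λ where
      (y , y∈xs , refl) →
        disjoint (here refl) (there y∈xs) (λ where refl → Unique[x∷xs]⇒x∉xs xs! y∈xs) (z∈fx , z∈fy)

map-unique-on : (f : A → A′) {xs : List A} → Unique xs →
                (∀ {x y} → x ∈ xs → y ∈ xs → f x ≡ f y → x ≡ y) → Unique (map f xs)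
map-unique-on f {[]}     []           _   = []
map-unique-on f {x ∷ xs} (x≢xs ∷ xs!) inj =
  All.map⁺ (All.tabulate λ y∈ fx≡fy → All.lookup x≢xs y∈ (inj (here refl) (there y∈) fx≡fy))
  ∷ map-unique-on f xs! (λ x∈ y∈ → inj (there x∈) (there y∈))

∈-insertions⁻ : ∀ {x} ys {zs} → zs ∈ insertions x ys → ∃₂ λ as bs → ys ≡ as ++ bs × zs ≡ as ++ x ∷ bs
∈-insertions⁻ []       (here refl) = [] , [] , refl , refl
∈-insertions⁻ (y ∷ ys) (here refl) = [] , y ∷ ys , refl , refl
∈-insertions⁻ (y ∷ ys) (there zs∈) with ∈-map⁻ (y ∷_) zs∈
... | zs′ , zs′∈ , refl with ∈-insertions⁻ ys zs′∈
...   | as , bs , refl , refl = y ∷ as , bs , refl , refl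

∈-insertions⁺ : ∀ {x} as bs → as ++ x ∷ bs ∈ insertions x (as ++ bs)
∈-insertions⁺ []       []       = here refl
∈-insertions⁺ []       (b ∷ bs) = here refl
∈-insertions⁺ (a ∷ as) bs       = there (∈-map⁺ (a ∷_) (∈-insertions⁺ as bs))

++-∷-injective : ∀ {x : A} as as′ {bs bs′} → x ∉ as → x ∉ as′ →
                 as ++ x ∷ bs ≡ as′ ++ x ∷ bs′ → as ≡ as′ × bs ≡ bs′
++-∷-injective []       []         _     _      refl = refl , refl
++-∷-injective []       (_ ∷ _)    _     x∉as′  refl = ⊥-elim (x∉as′ (here refl))
++-∷-injective (_ ∷ _)  []         x∉as  _      refl = ⊥-elim (x∉as (here refl))
++-∷-injective (a ∷ as) (a′ ∷ as′) x∉as  x∉as′  eq with ∷-injective eq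
... | refl , eq′ with ++-∷-injective as as′ (x∉as ∘ there) (x∉as′ ∘ there) eq′
...   | refl , refl = refl , refl

insertions-unique : ∀ {x} ys → x ∉ ys → Unique (insertions x ys)
insertions-unique []       _     = [] ∷ []
insertions-unique {x} (y ∷ ys) x∉y∷ys =
  unique∷ head∉ (map⁺ ∷-injectiveʳ (insertions-unique ys (x∉y∷ys ∘ there)))
  where
  head∉ : x ∷ y ∷ ys ∉ map (y ∷_) (insertions x ys)
  head∉ ∈map with ∈-map⁻ (y ∷_) ∈map
  ... | _ , _ , refl = x∉y∷ys (here refl)

insertions-disjoint : ∀ {x} ys ys′ → x ∉ ys → x ∉ ys′ → ys ≢ ys′ →
                      Disjoint (insertions x ys) (insertions x ys′)
insertions-disjoint ys ys′ x∉ys x∉ys′ ys≢ys′ (zs∈ , zs∈′)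
  with ∈-insertions⁻ ys zs∈ | ∈-insertions⁻ ys′ zs∈′
... | as , bs , refl , refl | as′ , bs′ , refl , zs≡
  with refl , refl ← ++-∷-injective as as′ (x∉ys ∘ ∈-++⁺ˡ) (x∉ys′ ∘ ∈-++⁺ˡ) zs≡ = ys≢ys′ refl

∈-perms⁻ : ∀ xs {σ} → σ ∈ perms xs → σ ↭ xs
∈-perms⁻ []       (here refl) = ↭-refl
∈-perms⁻ (x ∷ xs) σ∈ with ∈-concat⁻′ (map (insertions x) (perms xs)) σ∈
... | _ , σ∈ins , ins∈ with ∈-map⁻ (insertions x) ins∈
...   | ys , ys∈ , refl with ∈-insertions⁻ ys σ∈ins
...     | as , bs , refl , refl = ↭-trans (↭.shift x as bs) (↭-prep x (∈-perms⁻ xs ys∈))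

∈-perms⁺ : ∀ xs {σ} → σ ↭ xs → σ ∈ perms xs
∈-perms⁺ []       σ↭[] rewrite ↭.↭-empty-inv σ↭[] = here refl
∈-perms⁺ (x ∷ xs) σ↭ with ∈-∃++ (↭.∈-resp-↭ (↭-sym σ↭) (here refl))
... | as , bs , refl = ∈-concat⁺′ (∈-insertions⁺ as bs)
  (∈-map⁺ (insertions x) (∈-perms⁺ xs (↭.drop-∷ (↭-trans (↭-sym (↭.shift x as bs)) σ↭))))

perms-unique : ∀ xs → Unique xs → Unique (perms xs)
perms-unique []       _   = [] ∷ []
perms-unique (x ∷ xs) x∷xs! = concatMap-unique (insertions x) (perms-unique xs (tail x∷xs!))
  (λ {ys} ys∈ → insertions-unique ys (x∉ ys∈))
  (λ {ys} {ys′} ys∈ ys′∈ → insertions-disjoint ys ys′ (x∉ ys∈) (x∉ ys′∈))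
  where
  x∉ : ∀ {ys} → ys ∈ perms xs → x ∉ ys
  x∉ ys∈ = Unique[x∷xs]⇒x∉xs x∷xs! ∘ ↭.∈-resp-↭ (∈-perms⁻ xs ys∈)

∈-weakComps⁻ : ∀ N k {c} → c ∈ weakComps N k → length c ≡ k × sum c ≡ N
∈-weakComps⁻ zero    zero    (here refl) = refl , refl
∈-weakComps⁻ N       (suc k) c∈ with ∈-concat⁻′ (map (λ a → map (a ∷_) (weakComps (N ∸ a) k)) (upTo (suc N))) c∈
... | _ , c∈part , part∈ with ∈-map⁻ (λ a → map (a ∷_) (weakComps (N ∸ a) k)) part∈
...   | a , a∈ , refl with ∈-map⁻ (a ∷_) c∈part
...     | c′ , c′∈ , refl with ∈-weakComps⁻ (N ∸ a) k c′∈
...       | refl , sum≡ = refl , trans (cong (a +_) sum≡) (m+[n∸m]≡n (≤-pred (∈-upTo⁻ a∈)))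

∈-weakComps⁺ : ∀ c → c ∈ weakComps (sum c) (length c)
∈-weakComps⁺ []      = here refl
∈-weakComps⁺ (a ∷ c) = ∈-concat⁺′
  (∈-map⁺ (a ∷_) (subst (λ N → c ∈ weakComps N (length c)) (sym (m+n∸m≡n a (sum c))) (∈-weakComps⁺ c)))
  (∈-map⁺ (λ b → map (b ∷_) (weakComps (a + sum c ∸ b) (length c))) (∈-upTo⁺ (s≤s (m≤m+n a (sum c)))))

weakComps-unique : ∀ N k → Unique (weakComps N k)
weakComps-unique zero    zero    = [] ∷ []
weakComps-unique (suc N) zero    = []
weakComps-unique N       (suc k) = concatMap-unique (λ a → map (a ∷_) (weakComps (N ∸ a) k)) (upTo⁺ (suc N))
  (λ {a} _ → map⁺ ∷-injectiveʳ (weakComps-unique (N ∸ a) k))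
  (λ _ _ a≢b (c∈a , c∈b) → a≢b (same-head c∈a c∈b))
  where
  same-head : ∀ {a b c cs cs′} → c ∈ map (a ∷_) cs → c ∈ map (b ∷_) cs′ → a ≡ b
  same-head c∈a c∈b with ∈-map⁻ _ c∈a | ∈-map⁻ _ c∈b
  ... | _ , _ , refl | _ , _ , refl = refl

length≤sum : ∀ c → T (allPositive c) → length c ≤ sum c
length≤sum []          _   = z≤n
length≤sum (suc a ∷ c) pos = s≤s (≤-trans (length≤sum c pos) (m≤n+m (sum c) a))

∈-comps⁻ : ∀ n {c} → c ∈ comps n → T (allPositive c) × sum c ≡ n
∈-comps⁻ n c∈ with ∈-filter⁻ positive? {xs = concatMap (weakComps n) (upTo (suc n))} c∈
... | c∈all , pos with ∈-concat⁻′ (map (weakComps n) (upTo (suc n))) c∈all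
...   | _ , c∈part , part∈ with ∈-map⁻ (weakComps n) {xs = upTo (suc n)} part∈
...     | k , _ , refl = pos , proj₂ (∈-weakComps⁻ n k c∈part)

∈-comps⁺ : ∀ {c} → T (allPositive c) → c ∈ comps (sum c)
∈-comps⁺ {c} pos = ∈-filter⁺ positive?
  (∈-concat⁺′ (∈-weakComps⁺ c) (∈-map⁺ (weakComps (sum c)) (∈-upTo⁺ (s≤s (length≤sum c pos))))) pos

comps-unique : ∀ n → Unique (comps n)
comps-unique n = filter⁺ positive? (concatMap-unique (weakComps n) (upTo⁺ (suc n)) (λ {k} _ → weakComps-unique n k)
  (λ {k} {k′} _ _ k≢k′ (c∈k , c∈k′) →
    k≢k′ (trans (sym (proj₁ (∈-weakComps⁻ n k c∈k))) (proj₁ (∈-weakComps⁻ n k′ c∈k′)))))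


-- Avoiding 312 and 321

∈-subseqs⁻ : ∀ σ {s} → s ∈ subseqs σ → s ⊆ σ
∈-subseqs⁻ []       (here refl) = []
∈-subseqs⁻ (x ∷ σ)  s∈ with ∈-++⁻ (map (x ∷_) (subseqs σ)) s∈
... | inj₁ s∈with with ∈-map⁻ (x ∷_) s∈with
...   | s , s∈σ , refl = refl ∷ ∈-subseqs⁻ σ s∈σ
∈-subseqs⁻ (x ∷ σ)  s∈ | inj₂ s∈without = x ∷ʳ ∈-subseqs⁻ σ s∈without

∈-subseqs⁺ : ∀ {s σ} → s ⊆ σ → s ∈ subseqs σ
∈-subseqs⁺ []                  = here refl
∈-subseqs⁺ (refl ∷ s⊆σ)        = ∈-++⁺ˡ (∈-map⁺ _ (∈-subseqs⁺ s⊆σ))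
∈-subseqs⁺ {σ = y ∷ σ} (y ∷ʳ s⊆σ) = ∈-++⁺ʳ (map (y ∷_) (subseqs σ)) (∈-subseqs⁺ s⊆σ)

Occurrence : List ℕ → List ℕ → Set
Occurrence σ π = ∃ λ s → s ⊆ σ × T (sameLength s π ∧ orderIso s π)

contains⁻ : ∀ σ π → T (contains σ π) → Occurrence σ π
contains⁻ σ π t with find (any⁻ _ (subseqs σ) t)
... | s , s∈ , occ = s , ∈-subseqs⁻ σ s∈ , occ

contains⁺ : ∀ σ π → Occurrence σ π → T (contains σ π)
contains⁺ σ π (s , s⊆σ , occ) = any⁺ _ (lose (∈-subseqs⁺ s⊆σ) occ)

avoids⁻ : ∀ σ π → T (avoids σ π) → ¬ T (contains σ π)
avoids⁻ σ π with contains σ π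
... | true  = λ ()
... | false = λ _ ()

avoids⁺ : ∀ σ π → ¬ T (contains σ π) → T (avoids σ π)
avoids⁺ σ π with contains σ π
... | true  = λ ¬t → ¬t tt
... | false = λ _ → tt

-- Abstracting the four comparisons that orderIso inspects lets the boolean formula compute.
orderIso₃⁻ : ∀ a b c p q r → T (orderIso (a ∷ b ∷ c ∷ []) (p ∷ q ∷ r ∷ [])) →
             T ((b <ᵇ a) == (q <ᵇ p)) × T ((c <ᵇ a) == (r <ᵇ p))
orderIso₃⁻ a b c p q r t
  with (a <ᵇ b) == (p <ᵇ q) | (b <ᵇ a) == (q <ᵇ p) | (a <ᵇ c) == (p <ᵇ r) | (c <ᵇ a) == (r <ᵇ p)
... | true | true | true | true = tt , tt
orderIso₃⁻ _ _ _ _ _ _ () | false | _     | _     | _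
orderIso₃⁻ _ _ _ _ _ _ () | true  | false | _     | _
orderIso₃⁻ _ _ _ _ _ _ () | true  | true  | false | _
orderIso₃⁻ _ _ _ _ _ _ () | true  | true  | true  | false

p312 p321 : List ℕ
p312 = 3 ∷ 1 ∷ 2 ∷ []
p321 = 3 ∷ 2 ∷ 1 ∷ []

T-== : ∀ x y → T y → T (x == y) → T x
T-== true  _    _ _ = tt
T-== false true _ ()

<ᵇ-true : ∀ {m n} → m < n → (m <ᵇ n) ≡ true
<ᵇ-true m<n = Equivalence.to T-≡ (<⇒<ᵇ m<n)

<ᵇ-false : ∀ {m n} → n ≤ m → (m <ᵇ n) ≡ false
<ᵇ-false {m} {n} n≤m with m <ᵇ n in eq
... | false = refl
... | true  = ⊥-elim (≤⇒≯ n≤m (<ᵇ⇒< m n (subst T (sym eq) tt)))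

TwoBelow : List ℕ → Set
TwoBelow σ = ∃₂ λ a b → ∃ λ c → (a ∷ b ∷ c ∷ []) ⊆ σ × b < a × c < a

occurrence⇒TwoBelow : ∀ σ {q r} → T (q <ᵇ 3) → T (r <ᵇ 3) → Occurrence σ (3 ∷ q ∷ r ∷ []) → TwoBelow σ
occurrence⇒TwoBelow σ {q} {r} q<3 r<3 (a ∷ b ∷ c ∷ [] , s⊆σ , iso) with orderIso₃⁻ a b c 3 q r iso
... | b<a , c<a =
  a , b , c , s⊆σ , <ᵇ⇒< b a (T-== (b <ᵇ a) (q <ᵇ 3) q<3 b<a) , <ᵇ⇒< c a (T-== (c <ᵇ a) (r <ᵇ 3) r<3 c<a)

occurrence-312 : ∀ {σ a b c} → (a ∷ b ∷ c ∷ []) ⊆ σ → b < a → c < a → b < c → Occurrence σ p312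
occurrence-312 {a = a} {b} {c} s⊆σ b<a c<a b<c = _ , s⊆σ , iso
  where
  iso : T (orderIso (a ∷ b ∷ c ∷ []) p312)
  iso rewrite <ᵇ-true b<a | <ᵇ-true c<a | <ᵇ-true b<c
            | <ᵇ-false (<⇒≤ b<a) | <ᵇ-false (<⇒≤ c<a) | <ᵇ-false (<⇒≤ b<c) = tt

occurrence-321 : ∀ {σ a b c} → (a ∷ b ∷ c ∷ []) ⊆ σ → b < a → c < a → c < b → Occurrence σ p321
occurrence-321 {a = a} {b} {c} s⊆σ b<a c<a c<b = _ , s⊆σ , iso
  where
  iso : T (orderIso (a ∷ b ∷ c ∷ []) p321)
  iso rewrite <ᵇ-true b<a | <ᵇ-true c<a | <ᵇ-true c<b
            | <ᵇ-false (<⇒≤ b<a) | <ᵇ-false (<⇒≤ c<a) | <ᵇ-false (<⇒≤ c<b) = tt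

Avoids312∧321 : List ℕ → Set
Avoids312∧321 σ = T (avoids σ p312 ∧ avoids σ p321)

⊆-unique-distinct : ∀ {σ : List ℕ} {a b c} → Unique σ → (a ∷ b ∷ c ∷ []) ⊆ σ → b ≢ c
⊆-unique-distinct (_ ∷ σ!) (_ ∷ʳ s⊆σ)  = ⊆-unique-distinct σ! s⊆σ
⊆-unique-distinct (_ ∷ σ!) (refl ∷ s⊆σ) = distinct σ! s⊆σ
  where
  distinct : ∀ {σ : List ℕ} {b c} → Unique σ → (b ∷ c ∷ []) ⊆ σ → b ≢ c
  distinct (_ ∷ σ!) (_ ∷ʳ s⊆σ)      = distinct σ! s⊆σ
  distinct (b∉ ∷ _) (refl ∷ c⊆σ) refl = All.lookup b∉ (to∈ c⊆σ) refl

avoids⇒¬TwoBelow : ∀ {σ} → Unique σ → Avoids312∧321 σ → ¬ TwoBelow σ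
avoids⇒¬TwoBelow {σ} σ! av (a , b , c , s⊆σ , b<a , c<a) with Equivalence.to T-∧ av | <-cmp b c
... | av312 , _     | tri< b<c _ _ = avoids⁻ σ p312 av312 (contains⁺ σ p312 (occurrence-312 s⊆σ b<a c<a b<c))
... | _     , _     | tri≈ _ b≡c _ = ⊆-unique-distinct σ! s⊆σ b≡c
... | _     , av321 | tri> _ _ c<b = avoids⁻ σ p321 av321 (contains⁺ σ p321 (occurrence-321 s⊆σ b<a c<a c<b))

¬TwoBelow⇒avoids : ∀ {σ} → ¬ TwoBelow σ → Avoids312∧321 σ
¬TwoBelow⇒avoids {σ} ¬two = Equivalence.from T-∧
  ( avoids⁺ σ p312 (¬two ∘ occurrence⇒TwoBelow σ tt tt ∘ contains⁻ σ p312)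
  , avoids⁺ σ p321 (¬two ∘ occurrence⇒TwoBelow σ tt tt ∘ contains⁻ σ p321))

data AtMostOneBelow (x : ℕ) : List ℕ → Set where
  []    : AtMostOneBelow x []
  _∷_   : ∀ {y ys} → x ≤ y → AtMostOneBelow x ys → AtMostOneBelow x (y ∷ ys)
  below : ∀ {y ys} → y < x → All (x ≤_) ys → AtMostOneBelow x (y ∷ ys)

data NoTwoBelow : List ℕ → Set where
  []  : NoTwoBelow []
  _∷_ : ∀ {x xs} → AtMostOneBelow x xs → NoTwoBelow xs → NoTwoBelow (x ∷ xs)

All≤⇒AtMostOneBelow : ∀ {x ys} → All (x ≤_) ys → AtMostOneBelow x ys
All≤⇒AtMostOneBelow []           = []
All≤⇒AtMostOneBelow (x≤y ∷ x≤ys) = x≤y ∷ All≤⇒AtMostOneBelow x≤ys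

AtMostOneBelow-tail : ∀ {x y ys} → AtMostOneBelow x (y ∷ ys) → AtMostOneBelow x ys
AtMostOneBelow-tail (_ ∷ rest)       = rest
AtMostOneBelow-tail (below _ x≤rest) = All≤⇒AtMostOneBelow x≤rest

NoTwoBelow⇒¬TwoBelow : ∀ {σ} → NoTwoBelow σ → ¬ TwoBelow σ
NoTwoBelow⇒¬TwoBelow (_ ∷ σ-ok) (a , b , c , _ ∷ʳ s⊆σ , b<a , c<a) =
  NoTwoBelow⇒¬TwoBelow σ-ok (a , b , c , s⊆σ , b<a , c<a)
NoTwoBelow⇒¬TwoBelow (a-ok ∷ _) (a , b , c , refl ∷ s⊆σ , b<a , c<a) = no-pair a-ok s⊆σ b<a c<a
  where
  no-pair : ∀ {a b c ys} → AtMostOneBelow a ys → (b ∷ c ∷ []) ⊆ ys → b < a → c < a → ⊥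
  no-pair a-ok               (_ ∷ʳ s⊆ys)  = no-pair (AtMostOneBelow-tail a-ok) s⊆ys
  no-pair (a≤b ∷ _)          (refl ∷ _)   b<a _   = <⇒≱ b<a a≤b
  no-pair (below _ a≤rest)   (refl ∷ c⊆)  _   c<a = <⇒≱ c<a (All.lookup a≤rest (to∈ c⊆))

¬TwoBelow⇒NoTwoBelow : ∀ {σ} → ¬ TwoBelow σ → NoTwoBelow σ
¬TwoBelow⇒NoTwoBelow {[]}    _    = []
¬TwoBelow⇒NoTwoBelow {x ∷ σ} ¬two =
  at-most-one σ (λ {b} {c} bc⊆σ b<x c<x → ¬two (x , b , c , refl ∷ bc⊆σ , b<x , c<x))
  ∷ ¬TwoBelow⇒NoTwoBelow (λ (a , b , c , s⊆σ , b<a , c<a) → ¬two (a , b , c , x ∷ʳ s⊆σ , b<a , c<a))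
  where
  at-most-one : ∀ ys → (∀ {b c} → (b ∷ c ∷ []) ⊆ ys → b < x → c < x → ⊥) → AtMostOneBelow x ys
  at-most-one []       _       = []
  at-most-one (y ∷ ys) no-pair with x ≤? y
  ... | yes x≤y = x≤y ∷ at-most-one ys (λ bc⊆ → no-pair (y ∷ʳ bc⊆))
  ... | no  x≰y =
    below (≰⇒> x≰y) (All.tabulate λ z∈ys → ≮⇒≥ λ z<x → no-pair (refl ∷ from∈ z∈ys) (≰⇒> x≰y) z<x)


-- Direct sums of the permutations w_m

interval : ℕ → ℕ → List ℕ
interval lo zero    = []
interval lo (suc n) = lo ∷ interval (suc lo) n

applyUpTo≡interval : ∀ (f : ℕ → ℕ) lo n → (∀ i → f i ≡ i + lo) → applyUpTo f n ≡ interval lo n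
applyUpTo≡interval f lo zero    _   = refl
applyUpTo≡interval f lo (suc n) f≗ = cong₂ _∷_ (f≗ 0)
  (applyUpTo≡interval (f ∘ suc) (suc lo) n (λ i → trans (f≗ (suc i)) (sym (+-suc i lo))))

applyUpTo-suc≡interval : ∀ n → applyUpTo suc n ≡ interval 1 n
applyUpTo-suc≡interval n = applyUpTo≡interval suc 1 n (λ i → +-comm 1 i)

interval-++ : ∀ lo m n → interval lo (m + n) ≡ interval lo m ++ interval (lo + m) n
interval-++ lo zero    n = cong (λ lo′ → interval lo′ n) (sym (+-identityʳ lo))
interval-++ lo (suc m) n = cong (lo ∷_) (trans (interval-++ (suc lo) m n)
  (cong (λ lo′ → interval (suc lo) m ++ interval lo′ n) (sym (+-suc lo m))))

map-+-interval : ∀ k lo n → map (_+ k) (interval lo n) ≡ interval (lo + k) n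
map-+-interval k lo zero    = refl
map-+-interval k lo (suc n) = cong (lo + k ∷_) (map-+-interval k (suc lo) n)

interval-≥ : ∀ lo n → All (lo ≤_) (interval lo n)
interval-≥ lo zero    = []
interval-≥ lo (suc n) = ≤-refl ∷ All.map (≤-trans (n≤1+n lo)) (interval-≥ (suc lo) n)

length-interval : ∀ lo n → length (interval lo n) ≡ n
length-interval lo zero    = refl
length-interval lo (suc n) = cong suc (length-interval (suc lo) n)

interval-unique : ∀ lo n → Unique (interval lo n)
interval-unique lo zero    = []
interval-unique lo (suc n) =
  unique∷ (λ lo∈ → 1+n≰n (All.lookup (interval-≥ (suc lo) n) lo∈)) (interval-unique (suc lo) n)

w≡interval : ∀ p → w (suc p) ≡ interval 2 p ++ 1 ∷ []
w≡interval p = cong (_++ 1 ∷ []) (applyUpTo≡interval (λ i → i + 2) 2 p (λ _ → refl))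

length-w : ∀ m → length (w m) ≡ m
length-w zero    = refl
length-w (suc p) = begin
  length (w (suc p))                       ≡⟨ cong length (w≡interval p) ⟩
  length (interval 2 p ++ 1 ∷ [])          ≡⟨ length-++ (interval 2 p) ⟩
  length (interval 2 p) + 1                ≡⟨ cong (_+ 1) (length-interval 2 p) ⟩
  p + 1                                    ≡⟨ +-comm p 1 ⟩
  suc p                                    ∎

directSum-∷ : ∀ m c → directSum (m ∷ c) ≡ w m ++ map (_+ m) (directSum c)
directSum-∷ m c = cong (λ l → w m ++ map (_+ l) (directSum c)) (length-w m)

directSum-suc : ∀ p c → directSum (suc p ∷ c) ≡ interval 2 p ++ 1 ∷ map (_+ suc p) (directSum c)
directSum-suc p c = begin
  directSum (suc p ∷ c)                                 ≡⟨ directSum-∷ (suc p) c ⟩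
  w (suc p) ++ map (_+ suc p) (directSum c)             ≡⟨ cong (_++ map (_+ suc p) (directSum c)) (w≡interval p) ⟩
  (interval 2 p ++ 1 ∷ []) ++ map (_+ suc p) (directSum c) ≡⟨ ++-assoc (interval 2 p) (1 ∷ []) _ ⟩
  interval 2 p ++ 1 ∷ map (_+ suc p) (directSum c)      ∎

w↭interval : ∀ m → w m ↭ interval 1 m
w↭interval zero    = ↭-refl
w↭interval (suc p) rewrite w≡interval p = ↭-sym (↭.∷↭∷ʳ 1 (interval 2 p))

directSum↭interval : ∀ c → directSum c ↭ interval 1 (sum c)
directSum↭interval []      = ↭-refl
directSum↭interval (m ∷ c) rewrite directSum-∷ m c | interval-++ 1 m (sum c) =
  ↭.++⁺ (w↭interval m)
        (subst (map (_+ m) (directSum c) ↭_) (map-+-interval m 1 (sum c)) (↭.map⁺ (_+ m) (directSum↭interval c)))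

AtMostOneBelow-++ : ∀ {x} xs {ys} → All (x ≤_) xs → AtMostOneBelow x ys → AtMostOneBelow x (xs ++ ys)
AtMostOneBelow-++ []       []            x-ok = x-ok
AtMostOneBelow-++ (_ ∷ xs) (x≤y ∷ x≤xs) x-ok = x≤y ∷ AtMostOneBelow-++ xs x≤xs x-ok

AtMostOneBelow-map-+ : ∀ {x k ys} → AtMostOneBelow x ys → AtMostOneBelow (x + k) (map (_+ k) ys)
AtMostOneBelow-map-+         []                = []
AtMostOneBelow-map-+ {k = k} (x≤y ∷ x-ok)      = +-monoˡ-≤ k x≤y ∷ AtMostOneBelow-map-+ x-ok
AtMostOneBelow-map-+ {k = k} (below y<x x≤ys)  = below (+-monoˡ-< k y<x) (All.map⁺ (All.map (+-monoˡ-≤ k) x≤ys))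

NoTwoBelow-map-+ : ∀ {k σ} → NoTwoBelow σ → NoTwoBelow (map (_+ k) σ)
NoTwoBelow-map-+ []            = []
NoTwoBelow-map-+ (x-ok ∷ σ-ok) = AtMostOneBelow-map-+ x-ok ∷ NoTwoBelow-map-+ σ-ok

NoTwoBelow-interval-++ : ∀ lo r {z ys} → z < lo → All (lo + r ≤_) ys → NoTwoBelow ys →
                         NoTwoBelow (interval lo r ++ z ∷ ys)
NoTwoBelow-interval-++ lo zero    z<lo ys≥ ys-ok =
  All≤⇒AtMostOneBelow (All.map (λ y≥ → ≤-trans (<⇒≤ z<lo) (≤-trans (m≤m+n lo 0) y≥)) ys≥) ∷ ys-ok
NoTwoBelow-interval-++ lo (suc r) z<lo ys≥ ys-ok =
  AtMostOneBelow-++ (interval (suc lo) r) (All.map (≤-trans (n≤1+n lo)) (interval-≥ (suc lo) r))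
    (below z<lo (All.map (≤-trans (m≤m+n lo (suc r))) ys≥))
  ∷ NoTwoBelow-interval-++ (suc lo) r (m<n⇒m<1+n z<lo)
      (All.map (≤-trans (≤-reflexive (sym (+-suc lo r)))) ys≥) ys-ok

directSum-positive-entries : ∀ c → All (1 ≤_) (directSum c)
directSum-positive-entries c = ↭.All-resp-↭ (↭-sym (directSum↭interval c)) (interval-≥ 1 (sum c))

directSum-NoTwoBelow : ∀ c → NoTwoBelow (directSum c)
directSum-NoTwoBelow []          = []
directSum-NoTwoBelow (zero ∷ c)  = NoTwoBelow-map-+ (directSum-NoTwoBelow c)
directSum-NoTwoBelow (suc p ∷ c) rewrite directSum-suc p c = NoTwoBelow-interval-++ 2 p (s≤s (s≤s z≤n))
  (All.map⁺ (All.map (+-monoˡ-≤ (suc p)) (directSum-positive-entries c)))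
  (NoTwoBelow-map-+ (directSum-NoTwoBelow c))

1∉interval2 : ∀ p → 1 ∉ interval 2 p
1∉interval2 p 1∈ with All.lookup (interval-≥ 2 p) 1∈
... | s≤s ()

directSum-suc-nonempty : ∀ p c → directSum (suc p ∷ c) ≢ []
directSum-suc-nonempty p c eq with ++-conicalʳ (interval 2 p) _ (trans (sym (directSum-suc p c)) eq)
... | ()

directSum-injective : ∀ {c c′} → T (allPositive c) → T (allPositive c′) →
                      directSum c ≡ directSum c′ → c ≡ c′
directSum-injective {[]}        {[]}          _   _    _  = refl
directSum-injective {[]}        {suc p′ ∷ c′} _   _    eq = ⊥-elim (directSum-suc-nonempty p′ c′ (sym eq))
directSum-injective {suc p ∷ c} {[]}          _   _    eq = ⊥-elim (directSum-suc-nonempty p c eq)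
directSum-injective {suc p ∷ c} {suc p′ ∷ c′} pos pos′ eq
  with ++-∷-injective (interval 2 p) (interval 2 p′) (1∉interval2 p) (1∉interval2 p′)
         (trans (sym (directSum-suc p c)) (trans eq (directSum-suc p′ c′)))
... | same-block , same-rest
  with refl ← trans (sym (length-interval 2 p)) (trans (cong length same-block) (length-interval 2 p′))
  = cong (suc p ∷_) (directSum-injective pos pos′ (map-injective (λ {a} {b} → +-cancelʳ-≡ (suc p) a b) same-rest))

PrefixBelowRest : List ℕ → List ℕ → Set
PrefixBelowRest []       bs = ⊤
PrefixBelowRest (a ∷ as) bs = All (a ≤_) (as ++ bs) × PrefixBelowRest as bs

AtMostOneBelow-others : ∀ {x} xs {z ys} → AtMostOneBelow x (xs ++ z ∷ ys) → z < x → All (x ≤_) (xs ++ ys)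
AtMostOneBelow-others []       (x≤z ∷ _)      z<x = ⊥-elim (<⇒≱ z<x x≤z)
AtMostOneBelow-others []       (below _ x≤ys) _   = x≤ys
AtMostOneBelow-others (_ ∷ xs) (x≤y ∷ x-ok)   z<x = x≤y ∷ AtMostOneBelow-others xs x-ok z<x
AtMostOneBelow-others (_ ∷ xs) (below _ x≤rest) z<x =
  ⊥-elim (<⇒≱ z<x (All.lookup x≤rest (∈-++⁺ʳ xs (here refl))))

NoTwoBelow-++⁻ʳ : ∀ xs {ys} → NoTwoBelow (xs ++ ys) → NoTwoBelow ys
NoTwoBelow-++⁻ʳ []       ok       = ok
NoTwoBelow-++⁻ʳ (_ ∷ xs) (_ ∷ ok) = NoTwoBelow-++⁻ʳ xs ok

before-minimum : ∀ as {z bs} → NoTwoBelow (as ++ z ∷ bs) → All (z <_) as → PrefixBelowRest as bs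
before-minimum []       _             _            = tt
before-minimum (a ∷ as) (a-ok ∷ ok)   (z<a ∷ z<as) = AtMostOneBelow-others as a-ok z<a , before-minimum as ok z<as

PrefixBelowRest-interval : ∀ as bs lo N → as ++ bs ↭ interval lo N → PrefixBelowRest as bs →
                           as ≡ interval lo (length as)
PrefixBelowRest-interval []       bs lo N       _  _                 = refl
PrefixBelowRest-interval (a ∷ as) bs lo zero    p  _                 = ⊥-elim (↭.¬x∷xs↭[] p)
PrefixBelowRest-interval (a ∷ as) bs lo (suc N) p  (a≤rest , prefix) with a≡lo
  where
  a≡lo : a ≡ lo
  a≡lo with ↭.∈-resp-↭ (↭-sym p) (here refl)
  ... | here lo≡a  = sym lo≡a
  ... | there lo∈  =
    ≤-antisym (All.lookup a≤rest lo∈) (All.lookup (interval-≥ lo (suc N)) (↭.∈-resp-↭ p (here refl)))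
... | refl = cong (a ∷_) (PrefixBelowRest-interval as bs (suc a) N (↭.drop-∷ p) prefix)

↭-cancelˡ-++ : ∀ (as : List ℕ) {bs cs} → as ++ bs ↭ as ++ cs → bs ↭ cs
↭-cancelˡ-++ []       p = p
↭-cancelˡ-++ (a ∷ as) p = ↭-cancelˡ-++ as (↭.drop-∷ p)

map-+-map-+ : ∀ k m (xs : List ℕ) → map (_+ k) (map (_+ m) xs) ≡ map (_+ (k + m)) xs
map-+-map-+ k m []       = refl
map-+-map-+ k m (x ∷ xs) = cong₂ _∷_ (trans (+-assoc x m k) (cong (x +_) (+-comm m k))) (map-+-map-+ k m xs)

map-+0 : ∀ (xs : List ℕ) → map (_+ 0) xs ≡ xs
map-+0 xs = trans (map-cong +-identityʳ xs) (map-id xs)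

DirectSumOfW : ℕ → ℕ → List ℕ → Set
DirectSumOfW n k σ = ∃ λ c → T (allPositive c) × sum c ≡ n × σ ≡ map (_+ k) (directSum c)

NoTwoBelow⇒DirectSumOfW : ∀ n k σ → σ ↭ interval (suc k) n → NoTwoBelow σ → DirectSumOfW n k σ
NoTwoBelow⇒DirectSumOfW =
  <-rec (λ n → ∀ k σ → σ ↭ interval (suc k) n → NoTwoBelow σ → DirectSumOfW n k σ) step
  where
  step : ∀ n → (∀ {M} → M < n → ∀ k σ → σ ↭ interval (suc k) M → NoTwoBelow σ → DirectSumOfW M k σ) →
         ∀ k σ → σ ↭ interval (suc k) n → NoTwoBelow σ → DirectSumOfW n k σ
  step zero     _  k σ σ↭ _ = [] , tt , refl , ↭.↭-empty-inv σ↭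
  step (suc n′) ih k σ σ↭ σ-ok with ∈-∃++ (↭.∈-resp-↭ (↭-sym σ↭) (here refl))
  ... | as , bs , refl = suc p ∷ c′ , pos′ , cong suc (trans (cong (p +_) sum≡) p+M≡n′) , σ≡
    where
    p = length as
    M = length bs
    σ! : Unique (as ++ suc k ∷ bs)
    σ! = unique-resp-↭ (↭-sym σ↭) (interval-unique (suc k) (suc n′))
    rest↭ : as ++ bs ↭ interval (suc (suc k)) n′
    rest↭ = ↭.drop-∷ (↭-trans (↭-sym (↭.shift (suc k) as bs)) σ↭)
    as>min : All (suc k <_) as
    as>min = All.tabulate λ a∈ → ≤∧≢⇒<
      (All.lookup (interval-≥ (suc k) (suc n′)) (↭.∈-resp-↭ σ↭ (∈-++⁺ˡ a∈)))
      (λ where refl → Unique[x∷xs]⇒x∉xs (unique-resp-↭ (↭.shift (suc k) as bs) σ!) (∈-++⁺ˡ a∈))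
    as≡ : as ≡ interval (suc (suc k)) p
    as≡ = PrefixBelowRest-interval as bs _ n′ rest↭ (before-minimum as σ-ok as>min)
    p+M≡n′ : p + M ≡ n′
    p+M≡n′ = trans (sym (length-++ as)) (trans (↭.↭-length rest↭) (length-interval _ n′))
    bs↭ : bs ↭ interval (suc (k + suc p)) M
    bs↭ = ↭-cancelˡ-++ as (subst (as ++ bs ↭_) (begin
      interval (suc (suc k)) n′
        ≡⟨ cong (interval (suc (suc k))) p+M≡n′ ⟨
      interval (suc (suc k)) (p + M)
        ≡⟨ interval-++ (suc (suc k)) p M ⟩
      interval (suc (suc k)) p ++ interval (suc (suc k) + p) M
        ≡⟨ cong₂ (λ xs lo → xs ++ interval lo M) (sym as≡) (cong suc (sym (+-suc k p))) ⟩
      as ++ interval (suc (k + suc p)) M ∎) rest↭)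
    rec = ih (s≤s (subst (M ≤_) p+M≡n′ (m≤n+m M p))) (k + suc p) bs bs↭
            (NoTwoBelow-++⁻ʳ (as ++ suc k ∷ []) (subst NoTwoBelow (sym (++-assoc as (suc k ∷ []) bs)) σ-ok))
    c′ = proj₁ rec
    pos′ = proj₁ (proj₂ rec)
    sum≡ = proj₁ (proj₂ (proj₂ rec))
    bs≡ = proj₂ (proj₂ (proj₂ rec))
    σ≡ : as ++ suc k ∷ bs ≡ map (_+ k) (directSum (suc p ∷ c′))
    σ≡ = begin
      as ++ suc k ∷ bs
        ≡⟨ cong₂ (λ xs ys → xs ++ suc k ∷ ys) (trans as≡ (sym (map-+-interval k 2 p)))
                                              (trans bs≡ (sym (map-+-map-+ k (suc p) (directSum c′)))) ⟩
      map (_+ k) (interval 2 p) ++ suc k ∷ map (_+ k) (map (_+ suc p) (directSum c′))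
        ≡⟨ map-++ (_+ k) (interval 2 p) _ ⟨
      map (_+ k) (interval 2 p ++ 1 ∷ map (_+ suc p) (directSum c′))
        ≡⟨ cong (map (_+ k)) (directSum-suc p c′) ⟨
      map (_+ k) (directSum (suc p ∷ c′)) ∎

eqList-sound : ∀ xs ys → T (eqList xs ys) → xs ≡ ys
eqList-sound []       []       _  = refl
eqList-sound (x ∷ xs) (y ∷ ys) eq with Equivalence.to T-∧ eq
... | x≡y , xs≡ys = cong₂ _∷_ (≡ᵇ⇒≡ x y x≡y) (eqList-sound xs ys xs≡ys)

eqList-refl : ∀ xs → T (eqList xs xs)
eqList-refl []       = tt
eqList-refl (x ∷ xs) = Equivalence.from T-∧ (≡⇒≡ᵇ x x refl , eqList-refl xs)

firstMatch-directSum : ∀ cs {c} → c ∈ cs → (∀ {c′} → c′ ∈ cs → T (allPositive c′)) →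
                       firstMatch (directSum c) cs ≡ c
firstMatch-directSum (c′ ∷ cs) {c} c∈ pos with eqList (directSum c′) (directSum c) in eq
... | true  = directSum-injective (pos (here refl)) (pos c∈) (eqList-sound _ _ (subst T (sym eq) tt))
... | false with c∈
...   | here refl = ⊥-elim (subst T eq (eqList-refl (directSum c)))
...   | there c∈cs = firstMatch-directSum cs c∈cs (pos ∘ there)

B-directSum : ∀ n {c} → c ∈ comps n → B n (directSum c) ≡ c
B-directSum n c∈ = firstMatch-directSum (comps n) c∈ (proj₁ ∘ ∈-comps⁻ n)


avoids312∧321? : Decidable Avoids312∧321
avoids312∧321? σ = T? (avoids σ p312 ∧ avoids σ p321)

pAv↭directSums : ∀ n → pAv312-321 n ↭ map directSum (comps n)
pAv↭directSums n = unique∧set⇒↭ pAv! directSums! (mk⇔ to from)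
  where
  interval! : Unique (applyUpTo suc n)
  interval! = subst Unique (sym (applyUpTo-suc≡interval n)) (interval-unique 1 n)
  pAv! : Unique (pAv312-321 n)
  pAv! = filter⁺ avoids312∧321? (perms-unique _ interval!)
  directSums! : Unique (map directSum (comps n))
  directSums! = map-unique-on directSum (comps-unique n)
    λ c∈ c′∈ → directSum-injective (proj₁ (∈-comps⁻ n c∈)) (proj₁ (∈-comps⁻ n c′∈))
  to : ∀ {σ} → σ ∈ pAv312-321 n → σ ∈ map directSum (comps n)
  to σ∈ with ∈-filter⁻ avoids312∧321? {xs = Sym n} σ∈
  ... | σ∈Sym , av with subst (_ ↭_) (applyUpTo-suc≡interval n) (∈-perms⁻ _ σ∈Sym)
  ... | σ↭ with NoTwoBelow⇒DirectSumOfW n 0 _ σ↭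
                 (¬TwoBelow⇒NoTwoBelow (avoids⇒¬TwoBelow (unique-resp-↭ (↭-sym σ↭) (interval-unique 1 n)) av))
  ... | c , pos , refl , refl =
    subst (_∈ map directSum (comps (sum c))) (sym (map-+0 (directSum c))) (∈-map⁺ directSum (∈-comps⁺ {c} pos))
  from : ∀ {σ} → σ ∈ map directSum (comps n) → σ ∈ pAv312-321 n
  from σ∈ with ∈-map⁻ directSum σ∈
  ... | c , c∈ , refl with ∈-comps⁻ n c∈
  ... | pos , refl = ∈-filter⁺ avoids312∧321?
    (∈-perms⁺ _ (subst (directSum c ↭_) (sym (applyUpTo-suc≡interval (sum c))) (directSum↭interval c)))
    (¬TwoBelow⇒avoids (NoTwoBelow⇒¬TwoBelow (directSum-NoTwoBelow c)))

sum-pAv≡sum-comps : ∀ n (g : List ℕ → ℕ) → sum (map (g ∘ B n) (pAv312-321 n)) ≡ sum (map g (comps n))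
sum-pAv≡sum-comps n g = begin
  sum (map (g ∘ B n) (pAv312-321 n))
    ≡⟨ sum-↭ (↭.map⁺ (g ∘ B n) (pAv↭directSums n)) ⟩
  sum (map (g ∘ B n) (map directSum (comps n)))
    ≡⟨ cong sum (map-∘ (comps n)) ⟨
  sum (map (g ∘ B n ∘ directSum) (comps n))
    ≡⟨ cong sum (map-cong-local (All.tabulate (cong g ∘ B-directSum n))) ⟩
  sum (map g (comps n)) ∎

corollary5p6 : ∀ (n : ℕ) → 1 ≤ n →
    (catalan n ≡ sum (map (λ π → product (map (λ i → catalan (i ∸ 1)) (B n π))) (pAv312-321 n)))
    × (catalan n ≡ sum (applyUpTo (λ j → sum (map (λ m → product (map catalan m)) (weakComps (n ∸ suc j) (suc j)))) n))
corollary5p6 (suc m) _ =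
  trans (catalan-suc≡sum-compositionSum m)
        (sym (trans (sum-pAv≡sum-comps (suc m) weight) (sum-comps≡sum-compositionSum catalan m)))
  , catalan-suc≡sum-compositionSum m
  where
  weight : List ℕ → ℕ
  weight c = product (map (λ i → catalan (i ∸ 1)) c)
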